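{- Fix $r\ge 2$ and integers $k_0,\dots,k_{r-2}\ge 3$. Then there exists a constant $C_{k_0,\dots,k_{r-2}}>0$ such that for all sufficiently large integers $u$, \[ S(r;k_0,\dots,k_{r-2},u) \le C_{k_0,\dots,k_{r-2}}\,\frac{u^{\sum_{i=0}^{r-2}(k_i-2)+1}}{(\log u)^{\sum_{i=0}^{r-2}(k_i-2)}}-1. \] In particular, for fixed integers $3\le s\le t$ there exists a constant $C_{s,t}>0$ such that for all sufficiently large $u$, \[ S(3;s,t,u)\le C_{s,t}\,\frac{u^{s+t-3}}{(\log u)^{s+t-4}}-1. \]
   Context: For an integer $k\ge 3$, let $\mathcal{L}(k)$ denote the linear equation $x_1+x_2+\cdots+x_{k-1}=x_k$ in positive integer variables. For integers $r\ge 1$ and $k_0,\dots,k_{r-1}\ge 3$, the generalized Schur number $S(r;k_0,\dots,k_{r-1})$ is the least positive integer $N$ such that for every coloring of $[1,N]=\{1,2,\dots,N\}$ with the $r$ colors $0,1,\dots,r-1$, there is some $i\in\{0,\dots,r-1\}$ and a solution $(x_1,\dots,x_{k_i})$ of $\mathcal{L}(k_i)$ with all $x_j\in[1,N]$ colored $i$. -}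

module Defs where

open import Data.Nat using (ℕ; zero; suc; _+_; _*_; _∸_; _^_; _≤_; _<_)
open import Data.Nat.Logarithm using (⌊log₂_⌋)
open import Data.Fin using (Fin)
open import Data.Vec using (Vec; []; _∷_; lookup; sum; map; _∷ʳ_)
open import Data.Vec.Relation.Unary.All using (All)
open import Data.Product using (Σ; _×_)
open import Relation.Binary.PropositionalEquality using (_≡_)

-- A monochromatic solution in colour i of L(k): x₁+…+x_{k-1} = x_k,
-- all x_j in [1,N] and coloured i.  xs = (x₁,…,x_{k-1}), y = x_k.
MonoSol : ℕ → ℕ → {r : ℕ} → (ℕ → Fin r) → Fin r → Set
MonoSol k N c i =
  Σ (Vec ℕ (k ∸ 1)) λ xs → Σ ℕ λ y →
    (sum xs ≡ y) × All (λ x → (1 ≤ x) × (x ≤ N) × (c x ≡ i)) (y ∷ xs)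

-- Every r-colouring of [1,N] has, for some colour i, a solution of
-- L(ks[i]) monochromatic in colour i.  (A colouring of [1,N] is
-- represented by any c : ℕ → Fin r; values outside [1,N] are irrelevant.)
-- The Schur number S(r;ks) is the least N with this property, so
-- "S(r;ks) ≤ M" is equivalent to "∃ N ≤ M with SchurProp ks N".
SchurProp : {r : ℕ} → Vec ℕ r → ℕ → Set
SchurProp {r} ks N = (c : ℕ → Fin r) → Σ (Fin r) λ i → MonoSol (lookup ks i) N c i

-- "S(r;ks) ≤ C · u^(b+1) / (log u)^b − 1", with the logarithm replaced by
-- ⌊log₂ u⌋ (equivalent up to the constant C):
-- there is N with SchurProp ks N and (N + 1) · ⌊log₂ u⌋^b ≤ C · u^(b+1).
SchurBound : {r : ℕ} → Vec ℕ r → (C b u : ℕ) → Set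
SchurBound ks C b u =
  Σ ℕ λ N → SchurProp ks N × ((N + 1) * (⌊log₂ u ⌋ ^ b) ≤ C * (u ^ (b + 1)))

excess : {m : ℕ} → Vec ℕ m → ℕ
excess ks = sum (map (λ k → k ∸ 2) ks)

{-# OPTIONS --safe #-}
-- Colour each pair p < q of [0, N] by c (q − p). If h < x₁ < ⋯ < x_{k−1} satisfy
-- c (x₁ − h) = c (x₂ − x₁) = ⋯ = c (x_{k−1} − x_{k−2}) = c (x_{k−1} − h) = j, the gaps telescope to
-- x_{k−1} − h and form a solution of L(k) in colour j. So it suffices to bound "cliques": sets all of
-- whose differences take colours in A. The points q above the least point h of a clique split by the
-- colour j of q − h; within the part of colour j a chain of k_j − 1 points with gaps coloured j would
-- finish a solution, and by the Gallai–Roy argument its absence splits the part into k_j − 2 cliques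
-- avoiding j. This recursion is cliqueBound. The colour whose parameter is u can be removed only once
-- along each branch, so cliqueBound is at most u · ramseyFactor K r, where K bounds the other
-- parameters: S(r; k₀, …, k_{r−2}, u) is linear in u. As ⌊log₂ u⌋ ≤ u, this gives the bound
-- C u^{b+1} / ⌊log₂ u⌋^b for every exponent b.
module Submission where

open import Defs
open import Data.Nat using (ℕ; zero; suc; _+_; _*_; _∸_; _^_; _≤_; _<_; z≤n; s≤s; >-nonZero)
open import Data.Nat.Properties hiding (_≟_)
open import Data.Nat.ListAction using () renaming (sum to ∑)
open import Data.Nat.Logarithm using (⌊log₂_⌋; ⌊log₂⌋-mono-≤; ⌊log₂[2^n]⌋≡n)
open import Data.Nat.Solver using (module +-*-Solver)
open import Data.Vec using (Vec; []; _∷_; lookup; _∷ʳ_; sum)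
open import Data.Vec.Relation.Unary.All using () renaming (All to AllV; [] to []ᵥ; _∷_ to _∷ᵥ_)
open import Data.Fin using (Fin; zero; suc; fromℕ; _≟_)
open import Data.Product using (Σ; _×_; _,_; proj₁; proj₂)
open import Data.Sum using (_⊎_; inj₁; inj₂)
open import Data.List using (List; []; _∷_; length; map; filter; allFin; upTo)
open import Data.List.Properties using (filter-notAll; length-tabulate; length-upTo)
open import Data.List.Membership.Propositional using (_∈_; _∉_; find)
open import Data.List.Membership.Propositional.Properties using (∈-filter⁺; ∈-filter⁻; ∈-allFin; ∈-upTo⁻)
open import Data.List.Relation.Unary.Any as Any using (Any; here; there; any?)
import Data.List.Relation.Unary.All as All
open import Data.List.Relation.Unary.AllPairs using (AllPairs; _∷_)
import Data.List.Relation.Unary.AllPairs.Properties as AllPairs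
open import Data.List.Relation.Binary.Sublist.Propositional.Properties using (length-mono-≤; filter⁺; filter-⊆)
open import Function using (_∘_)
open import Relation.Nullary using (yes; no)
open import Relation.Nullary.Decidable using (¬?; _×-dec_)
open import Relation.Unary using (Decidable)
open import Relation.Unary.Properties using (∁?)
open import Data.Empty using (⊥-elim)
open import Relation.Binary.PropositionalEquality

module _ {A : Set} {P : A → Set} (P? : Decidable P) where

  length-filter-∁ : ∀ xs → length xs ≡ length (filter P? xs) + length (filter (∁? P?) xs)
  length-filter-∁ [] = refl
  length-filter-∁ (x ∷ xs) with P? x
  ... | yes _ = cong suc (length-filter-∁ xs)
  ... | no _ = trans (cong suc (length-filter-∁ xs)) (sym (+-suc _ _))

module _ {A : Set} {g h : A → ℕ} where

  sum-map-mono : ∀ xs → (∀ {a} → a ∈ xs → g a ≤ h a) → ∑ (map g xs) ≤ ∑ (map h xs)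
  sum-map-mono [] _ = z≤n
  sum-map-mono (a ∷ xs) g≤h = +-mono-≤ (g≤h (here refl)) (sum-map-mono xs (g≤h ∘ there))

  sum-map-mono-⊎ : ∀ {S : Set} xs → (∀ {a} → a ∈ xs → S ⊎ g a ≤ h a) →
                   S ⊎ ∑ (map g xs) ≤ ∑ (map h xs)
  sum-map-mono-⊎ [] _ = inj₂ z≤n
  sum-map-mono-⊎ (a ∷ xs) g≤h with g≤h (here refl) | sum-map-mono-⊎ xs (g≤h ∘ there)
  ... | inj₁ s | _ = inj₁ s
  ... | inj₂ _ | inj₁ s = inj₁ s
  ... | inj₂ ≤a | inj₂ ≤xs = inj₂ (+-mono-≤ ≤a ≤xs)

sum-map-≤-length : ∀ {A : Set} {g : A → ℕ} {M} xs → (∀ {a} → a ∈ xs → g a ≤ M) →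
                   ∑ (map g xs) ≤ length xs * M
sum-map-≤-length [] _ = z≤n
sum-map-≤-length (a ∷ xs) g≤M = +-mono-≤ (g≤M (here refl)) (sum-map-≤-length xs (g≤M ∘ there))

length-≤-sum-fibres : ∀ {r} {X : Set} (f : X → Fin r) (A : List (Fin r)) (xs : List X) →
  (∀ {x} → x ∈ xs → f x ∈ A) → length xs ≤ ∑ (map (λ a → length (filter (λ x → f x ≟ a) xs)) A)
length-≤-sum-fibres f [] [] _ = z≤n
length-≤-sum-fibres f [] (x ∷ xs) fx∈[] with () ← fx∈[] (here refl)
length-≤-sum-fibres f (a ∷ A) xs fx∈A = begin
  length xs
    ≡⟨ length-filter-∁ (λ x → f x ≟ a) xs ⟩
  length (filter (λ x → f x ≟ a) xs) + length others
    ≤⟨ +-monoʳ-≤ _ (length-≤-sum-fibres f A others fx∈A') ⟩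
  length (filter (λ x → f x ≟ a) xs) + ∑ (map (λ b → length (filter (λ x → f x ≟ b) others)) A)
    ≤⟨ +-monoʳ-≤ _ (sum-map-mono A (λ {b} _ → fibre-mono b)) ⟩
  length (filter (λ x → f x ≟ a) xs) + ∑ (map (λ b → length (filter (λ x → f x ≟ b) xs)) A) ∎
  where
    open ≤-Reasoning
    others = filter (∁? (λ x → f x ≟ a)) xs
    fx∈A' : ∀ {x} → x ∈ others → f x ∈ A
    fx∈A' x∈ with ∈-filter⁻ (∁? (λ x → f x ≟ a)) x∈
    ... | x∈xs , fx≢a with fx∈A x∈xs
    ...   | here fx≡a = ⊥-elim (fx≢a fx≡a)
    ...   | there fx∈ = fx∈
    fibre-mono : ∀ b → length (filter (λ x → f x ≟ b) others) ≤ length (filter (λ x → f x ≟ b) xs)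
    fibre-mono b = length-mono-≤ (filter⁺ (λ x → f x ≟ b) (λ x → f x ≟ b) (λ { refl p → p })
                                          (filter-⊆ (∁? (λ x → f x ≟ a)) xs))

n≤2^n : ∀ n → n ≤ 2 ^ n
n≤2^n zero = z≤n
n≤2^n (suc n) = +-mono-≤ (m^n>0 2 n) (≤-trans (n≤2^n n) (m≤m+n (2 ^ n) 0))

⌊log₂n⌋≤n : ∀ n → ⌊log₂ n ⌋ ≤ n
⌊log₂n⌋≤n n = ≤-trans (⌊log₂⌋-mono-≤ (n≤2^n n)) (≤-reflexive (⌊log₂[2^n]⌋≡n n))

∸-telescope : ∀ {b x z} → b ≤ x → x ≤ z → (x ∸ b) + (z ∸ x) ≡ z ∸ b
∸-telescope {b} {x} {z} b≤x x≤z = begin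
  (x ∸ b) + (z ∸ x) ≡⟨ +-comm (x ∸ b) (z ∸ x) ⟩
  (z ∸ x) + (x ∸ b) ≡⟨ +-∸-assoc (z ∸ x) b≤x ⟨
  (z ∸ x) + x ∸ b   ≡⟨ cong (_∸ b) (m∸n+n≡m x≤z) ⟩
  z ∸ b             ∎
  where open ≡-Reasoning

module _ {r : ℕ} where

  _∖_ : List (Fin r) → Fin r → List (Fin r)
  A ∖ a = filter (λ b → ¬? (b ≟ a)) A

  length-∖ : ∀ {a A} → a ∈ A → length (A ∖ a) < length A
  length-∖ {a} {A} a∈A =
    filter-notAll (λ b → ¬? (b ≟ a)) A (Any.map (λ a≡b b≢a → b≢a (sym a≡b)) a∈A)

  ∖-⊆ : ∀ {a b A} → b ∈ A ∖ a → b ∈ A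
  ∖-⊆ {a} {A = A} = proj₁ ∘ ∈-filter⁻ (λ b → ¬? (b ≟ a)) {xs = A}

  ∉-∖ : ∀ {a A} → a ∉ A ∖ a
  ∉-∖ {a} {A} a∈ = proj₂ (∈-filter⁻ (λ b → ¬? (b ≟ a)) {xs = A} a∈) refl

cliqueBound : ∀ {r} → Vec ℕ r → ℕ → List (Fin r) → ℕ
cliqueBound ks zero A = 1
cliqueBound ks (suc n) A = suc (∑ (map (λ a → (lookup ks a ∸ 2) * cliqueBound ks n (A ∖ a)) A))

module Cliques {r : ℕ} (ks : Vec ℕ r) (ks≥2 : ∀ j → 2 ≤ lookup ks j) (N : ℕ) (c : ℕ → Fin r) where

  Solution : Set
  Solution = Σ (Fin r) λ i → MonoSol (lookup ks i) N c i

  record Clique (A : List (Fin r)) (P : List ℕ) : Set where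
    field
      increasing : AllPairs _<_ P
      bounded    : ∀ {x} → x ∈ P → x ≤ N
      coloured   : ∀ {p q} → p ∈ P → q ∈ P → p < q → c (q ∸ p) ∈ A

  open Clique

  clique-filter : ∀ {A P} {Q : ℕ → Set} (Q? : Decidable Q) → Clique A P → Clique A (filter Q? P)
  clique-filter Q? K = record
    { increasing = AllPairs.filter⁺ Q? (increasing K)
    ; bounded    = λ x∈ → bounded K (proj₁ (∈-filter⁻ Q? x∈))
    ; coloured   = λ p∈ q∈ → coloured K (proj₁ (∈-filter⁻ Q? p∈)) (proj₁ (∈-filter⁻ Q? q∈))
    }

  clique-tail : ∀ {A h P} → Clique A (h ∷ P) → Clique A P
  clique-tail K with increasing K
  ... | _ ∷ increasing-P = record
    { increasing = increasing-P
    ; bounded    = bounded K ∘ there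
    ; coloured   = λ p∈ q∈ → coloured K (there p∈) (there q∈)
    }

  clique-head< : ∀ {A h P q} → Clique A (h ∷ P) → q ∈ P → h < q
  clique-head< K q∈P with increasing K
  ... | h<P ∷ _ = All.lookup h<P q∈P

  data Chain (R : List ℕ) (j : Fin r) : ℕ → ℕ → ℕ → Set where
    single : ∀ {x} → x ∈ R → Chain R j 1 x x
    link   : ∀ {t x y z} → x ∈ R → x < y → c (y ∸ x) ≡ j → Chain R j t y z → Chain R j (suc t) x z

  HasChain : List ℕ → Fin r → ℕ → Set
  HasChain R j t = Σ ℕ λ x → Σ ℕ λ z → Chain R j t x z

  module _ {R : List ℕ} {j : Fin r} where

    chain-head : ∀ {t x z} → Chain R j t x z → x ∈ R
    chain-head (single x∈) = x∈
    chain-head (link x∈ _ _ _) = x∈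

    chain-last : ∀ {t x z} → Chain R j t x z → z ∈ R
    chain-last (single z∈) = z∈
    chain-last (link _ _ _ ch) = chain-last ch

    chain-≤ : ∀ {t x z} → Chain R j t x z → x ≤ z
    chain-≤ (single _) = ≤-refl
    chain-≤ (link _ x<y _ ch) = ≤-trans (<⇒≤ x<y) (chain-≤ ch)

    chain-map : ∀ {R′ t x z} → (∀ {v} → v ∈ R → v ∈ R′) → Chain R j t x z → Chain R′ j t x z
    chain-map R⊆R′ (single x∈) = single (R⊆R′ x∈)
    chain-map R⊆R′ (link x∈ x<y e ch) = link (R⊆R′ x∈) x<y e (chain-map R⊆R′ ch)

  Coloured : Fin r → ℕ → Set
  Coloured j x = (1 ≤ x) × (x ≤ N) × (c x ≡ j)

  difference-coloured : ∀ {j b x} → b < x → x ≤ N → c (x ∸ b) ≡ j → Coloured j (x ∸ b)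
  difference-coloured {b = b} {x} b<x x≤N e = m<n⇒0<n∸m b<x , ≤-trans (m∸n≤m x b) x≤N , e

  chain-increments : ∀ {R j t b x z} → (∀ {v} → v ∈ R → v ≤ N) → b < x → c (x ∸ b) ≡ j →
                     Chain R j t x z → Σ (Vec ℕ t) λ xs → (sum xs ≡ z ∸ b) × AllV (Coloured j) xs
  chain-increments R≤N b<x e (single x∈) =
    _ ∷ [] , +-identityʳ _ , difference-coloured b<x (R≤N x∈) e ∷ᵥ []ᵥ
  chain-increments {b = b} {x} {z} R≤N b<x e (link x∈ x<y e′ ch)
    with ys , ∑ys , ys-coloured ← chain-increments R≤N x<y e′ ch =
    (x ∸ b) ∷ ys ,
    trans (cong ((x ∸ b) +_) ∑ys) (∸-telescope (<⇒≤ b<x) (≤-trans (<⇒≤ x<y) (chain-≤ ch))) ,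
    difference-coloured b<x (R≤N x∈) e ∷ᵥ ys-coloured

  Fan : ℕ → Fin r → ℕ → Set
  Fan h a q = h < q × q ≤ N × c (q ∸ h) ≡ a

  chain-solution : ∀ {a h R x z} → (∀ {q} → q ∈ R → Fan h a q) →
                   Chain R a (lookup ks a ∸ 1) x z → Solution
  chain-solution {a} {h} {z = z} fan ch =
    let h<x , _ , cx = fan (chain-head ch)
        h<z , z≤N , cz = fan (chain-last ch)
        xs , ∑xs , xs-coloured = chain-increments (proj₁ ∘ proj₂ ∘ fan) h<x cx ch
    in a , xs , z ∸ h , ∑xs , difference-coloured h<z z≤N cz ∷ᵥ xs-coloured

  Predecessor : Fin r → List ℕ → ℕ → Set
  Predecessor j R x = Any (λ y → y < x × c (x ∸ y) ≡ j) R

  predecessor? : ∀ j R → Decidable (Predecessor j R)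
  predecessor? j R x = any? (λ y → (y <? x) ×-dec (c (x ∸ y) ≟ j)) R

  chain-prepend : ∀ {j R t x z} → Chain (filter (predecessor? j R) R) j t x z → HasChain R j (suc t)
  chain-prepend {j} {R} {z = z} ch with find (proj₂ (∈-filter⁻ (predecessor? j R) {xs = R} (chain-head ch)))
  ... | y , y∈R , y<x , e = y , z , link y∈R y<x e (chain-map (proj₁ ∘ ∈-filter⁻ (predecessor? j R)) ch)

  clique-sources : ∀ {A} j R → Clique A R → Clique (A ∖ j) (filter (∁? (predecessor? j R)) R)
  clique-sources {A} j R K = record
    { increasing = AllPairs.filter⁺ (∁? (predecessor? j R)) (increasing K)
    ; bounded    = bounded K ∘ proj₁ ∘ ∈-filter⁻ (∁? (predecessor? j R))
    ; coloured   = coloured-∖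
    }
    where
      coloured-∖ : ∀ {p q} → p ∈ filter (∁? (predecessor? j R)) R → q ∈ filter (∁? (predecessor? j R)) R →
                   p < q → c (q ∸ p) ∈ A ∖ j
      coloured-∖ p∈ q∈ p<q with p∈R , _ ← ∈-filter⁻ (∁? (predecessor? j R)) {xs = R} p∈
                             | q∈R , q-source ← ∈-filter⁻ (∁? (predecessor? j R)) {xs = R} q∈ =
        ∈-filter⁺ (λ b → ¬? (b ≟ j)) (coloured K p∈R q∈R p<q)
                  (λ e → q-source (Any.map (λ { refl → p<q , e }) p∈R))

  CliquesBounded : ℕ → Set
  CliquesBounded n = ∀ {A P} → length A ≤ n → Clique A P → Solution ⊎ length P ≤ cliqueBound ks n A

  -- Points of R without a j-predecessor form a clique avoiding j; a chain among the other points
  -- extends backwards by one point.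
  chain-or-small : ∀ {n A j} → CliquesBounded n → length (A ∖ j) ≤ n → ∀ t {R} → Clique A R →
                   Solution ⊎ HasChain R j (suc t) ⊎ length R ≤ t * cliqueBound ks n (A ∖ j)
  chain-or-small _ _ zero {[]} _ = inj₂ (inj₂ z≤n)
  chain-or-small _ _ zero {x ∷ _} _ = inj₂ (inj₁ (x , x , single (here refl)))
  chain-or-small {n} {A} {j} ih lA (suc t) {R} K
    with ih lA (clique-sources j R K) | chain-or-small ih lA t (clique-filter (predecessor? j R) K)
  ... | inj₁ s | _ = inj₁ s
  ... | inj₂ _ | inj₁ s = inj₁ s
  ... | inj₂ _ | inj₂ (inj₁ (_ , _ , ch)) = inj₂ (inj₁ (chain-prepend ch))
  ... | inj₂ few-sources | inj₂ (inj₂ few-others) = inj₂ (inj₂ (begin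
    length R                                  ≡⟨ length-filter-∁ (predecessor? j R) R ⟩
    length (filter (predecessor? j R) R) + _  ≤⟨ +-mono-≤ few-others few-sources ⟩
    t * bound + bound                         ≡⟨ +-comm (t * bound) bound ⟩
    suc t * bound                             ∎))
    where
      open ≤-Reasoning
      bound = cliqueBound ks n (A ∖ j)

  fibre : ℕ → Fin r → List ℕ → List ℕ
  fibre h a = filter (λ q → c (q ∸ h) ≟ a)

  fibre-small : ∀ {n A a h P} → CliquesBounded n → length A ≤ suc n → a ∈ A → Clique A P →
                (∀ {q} → q ∈ P → h < q) →
                Solution ⊎ length (fibre h a P) ≤ (lookup ks a ∸ 2) * cliqueBound ks n (A ∖ a)
  fibre-small {a = a} {h} {P} ih lA a∈A K above
    with chain-or-small ih (≤-pred (≤-trans (length-∖ a∈A) lA)) (lookup ks a ∸ 2)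
                        (clique-filter (λ q → c (q ∸ h) ≟ a) K)
  ... | inj₁ s = inj₁ s
  ... | inj₂ (inj₂ small) = inj₂ small
  ... | inj₂ (inj₁ (x , z , ch)) =
    inj₁ (chain-solution fan (subst (λ t → Chain (fibre h a P) a t x z) (sym (+-∸-assoc 1 (ks≥2 a))) ch))
    where
      fan : ∀ {q} → q ∈ fibre h a P → Fan h a q
      fan q∈ with q∈P , e ← ∈-filter⁻ (λ q → c (q ∸ h) ≟ a) {xs = P} q∈ =
        above q∈P , bounded K q∈P , e

  cliques-bounded : ∀ n → CliquesBounded n
  cliques-bounded zero {[]} {[]} _ _ = inj₂ z≤n
  cliques-bounded zero {[]} {_ ∷ []} _ _ = inj₂ ≤-refl
  cliques-bounded zero {[]} {_ ∷ _ ∷ _} _ K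
    with () ← coloured K (here refl) (there (here refl)) (clique-head< K (here refl))
  cliques-bounded (suc n) {A} {[]} _ _ = inj₂ z≤n
  cliques-bounded (suc n) {A} {h ∷ P} lA K
    with sum-map-mono-⊎ A (λ a∈A → fibre-small (cliques-bounded n) lA a∈A (clique-tail K) (clique-head< K))
  ... | inj₁ s = inj₁ s
  ... | inj₂ fibres-small = inj₂ (s≤s (≤-trans (length-≤-sum-fibres (λ q → c (q ∸ h)) A P colour∈A) fibres-small))
    where
      colour∈A : ∀ {q} → q ∈ P → c (q ∸ h) ∈ A
      colour∈A q∈P = coloured K (here refl) (there q∈P) (clique-head< K q∈P)

  initial-clique : Clique (allFin r) (upTo (suc N))
  initial-clique = record
    { increasing = AllPairs.applyUpTo⁺₁ (λ x → x) (suc N) (λ i<j _ → i<j)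
    ; bounded    = ≤-pred ∘ ∈-upTo⁻
    ; coloured   = λ _ _ _ → ∈-allFin _
    }

  solution : cliqueBound ks r (allFin r) ≤ N → Solution
  solution bound with cliques-bounded r (≤-reflexive (length-tabulate (λ x → x))) initial-clique
  ... | inj₁ s = s
  ... | inj₂ too-large =
    ⊥-elim (1+n≰n (≤-trans (≤-trans (≤-reflexive (sym (length-upTo (suc N)))) too-large) bound))

schurProp-cliqueBound : ∀ {r} (ks : Vec ℕ r) → (∀ j → 2 ≤ lookup ks j) →
                        ∀ {N} → cliqueBound ks r (allFin r) ≤ N → SchurProp ks N
schurProp-cliqueBound ks ks≥2 bound c = Cliques.solution ks ks≥2 _ c bound

ramseyFactor : ℕ → ℕ → ℕ
ramseyFactor K zero = 1
ramseyFactor K (suc n) = (suc n * K + 1) * ramseyFactor K n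

ramseyFactor>0 : ∀ K n → 0 < ramseyFactor K n
ramseyFactor>0 K zero = s≤s z≤n
ramseyFactor>0 K (suc n) = *-mono-≤ (m≤n+m 1 (suc n * K)) (ramseyFactor>0 K n)

module _ {r : ℕ} (ks : Vec ℕ r) (K : ℕ) (w : List (Fin r) → ℕ)
         (w>0 : ∀ A → 0 < w A)
         (w-step : ∀ {a A} → a ∈ A → (lookup ks a ∸ 2) * w (A ∖ a) ≤ K * w A) where

  cliqueBound-≤-weighted : ∀ n A → length A ≤ n → cliqueBound ks n A ≤ w A * ramseyFactor K n
  cliqueBound-≤-weighted zero A _ = ≤-trans (w>0 A) (≤-reflexive (sym (*-identityʳ (w A))))
  cliqueBound-≤-weighted (suc n) A lA = begin
    suc (∑ (map (λ a → (lookup ks a ∸ 2) * cliqueBound ks n (A ∖ a)) A))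
      ≤⟨ s≤s (sum-map-≤-length A term-≤) ⟩
    suc (length A * (K * (w A * E)))
      ≤⟨ s≤s (*-monoˡ-≤ (K * (w A * E)) lA) ⟩
    1 + suc n * (K * (w A * E))
      ≤⟨ +-monoˡ-≤ _ (*-mono-≤ (w>0 A) (ramseyFactor>0 K n)) ⟩
    w A * E + suc n * (K * (w A * E))
      ≡⟨ solve 4 (λ W n K E → W :* E :+ n :* (K :* (W :* E)) := W :* ((n :* K :+ con 1) :* E))
               refl (w A) (suc n) K E ⟩
    w A * ramseyFactor K (suc n) ∎
    where
      open ≤-Reasoning
      open +-*-Solver
      E = ramseyFactor K n
      term-≤ : ∀ {a} → a ∈ A → (lookup ks a ∸ 2) * cliqueBound ks n (A ∖ a) ≤ K * (w A * E)
      term-≤ {a} a∈A = begin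
        (lookup ks a ∸ 2) * cliqueBound ks n (A ∖ a)
          ≤⟨ *-monoʳ-≤ (lookup ks a ∸ 2)
               (cliqueBound-≤-weighted n (A ∖ a) (≤-pred (≤-trans (length-∖ a∈A) lA))) ⟩
        (lookup ks a ∸ 2) * (w (A ∖ a) * E)  ≡⟨ *-assoc (lookup ks a ∸ 2) _ _ ⟨
        (lookup ks a ∸ 2) * w (A ∖ a) * E    ≤⟨ *-monoˡ-≤ E (w-step a∈A) ⟩
        K * w A * E                          ≡⟨ *-assoc K _ _ ⟩
        K * (w A * E)                        ∎

-- The colour ℓ leaves A at most once along the recursion of cliqueBound, so its parameter u costs a
-- single factor u.
module _ {r : ℕ} (ℓ : Fin r) (u : ℕ) where

  colourWeight : List (Fin r) → ℕ
  colourWeight A with any? (ℓ ≟_) A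
  ... | yes _ = u
  ... | no _ = 1

  colourWeight-∈ : ∀ {A} → ℓ ∈ A → colourWeight A ≡ u
  colourWeight-∈ {A} ℓ∈A with any? (ℓ ≟_) A
  ... | yes _ = refl
  ... | no ℓ∉A = ⊥-elim (ℓ∉A ℓ∈A)

  colourWeight-∉ : ∀ {A} → ℓ ∉ A → colourWeight A ≡ 1
  colourWeight-∉ {A} ℓ∉A with any? (ℓ ≟_) A
  ... | yes ℓ∈A = ⊥-elim (ℓ∉A ℓ∈A)
  ... | no _ = refl

  module _ (u>0 : 0 < u) where

    colourWeight>0 : ∀ A → 0 < colourWeight A
    colourWeight>0 A with any? (ℓ ≟_) A
    ... | yes _ = u>0
    ... | no _ = ≤-refl

    colourWeight-mono : ∀ {A B} → (ℓ ∈ A → ℓ ∈ B) → colourWeight A ≤ colourWeight B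
    colourWeight-mono {A} {B} A⊆B with any? (ℓ ≟_) A | any? (ℓ ≟_) B
    ... | yes _ | yes _ = ≤-refl
    ... | yes ℓ∈A | no ℓ∉B = ⊥-elim (ℓ∉B (A⊆B ℓ∈A))
    ... | no _ | yes _ = u>0
    ... | no _ | no _ = ≤-refl

    colourWeight-step : ∀ {ks : Vec ℕ r} {K} → 0 < K →
                        lookup ks ℓ ∸ 2 ≤ u → (∀ j → j ≢ ℓ → lookup ks j ∸ 2 ≤ K) →
                        ∀ {a A} → a ∈ A → (lookup ks a ∸ 2) * colourWeight (A ∖ a) ≤ K * colourWeight A
    colourWeight-step {ks} {K} K>0 kℓ≤u kj≤K {a} {A} a∈A with a ≟ ℓ
    ... | yes refl rewrite colourWeight-∉ (∉-∖ {a = ℓ} {A = A}) | colourWeight-∈ a∈A = begin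
      (lookup ks ℓ ∸ 2) * 1 ≡⟨ *-identityʳ _ ⟩
      lookup ks ℓ ∸ 2       ≤⟨ kℓ≤u ⟩
      u                     ≤⟨ m≤n*m u K {{>-nonZero K>0}} ⟩
      K * u                 ∎
      where open ≤-Reasoning
    ... | no a≢ℓ = *-mono-≤ (kj≤K a a≢ℓ) (colourWeight-mono ∖-⊆)

schurProp-linear : ∀ {r} (ks : Vec ℕ r) (ℓ : Fin r) {K u : ℕ} →
                   (∀ j → 2 ≤ lookup ks j) → 0 < K → 0 < u →
                   lookup ks ℓ ∸ 2 ≤ u → (∀ j → j ≢ ℓ → lookup ks j ∸ 2 ≤ K) →
                   SchurProp ks (u * ramseyFactor K r)
schurProp-linear {r} ks ℓ {K} {u} ks≥2 K>0 u>0 kℓ≤u kj≤K = schurProp-cliqueBound ks ks≥2 (begin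
  cliqueBound ks r (allFin r)
    ≤⟨ cliqueBound-≤-weighted ks K (colourWeight ℓ u) (colourWeight>0 ℓ u u>0)
         (colourWeight-step ℓ u u>0 {ks} K>0 kℓ≤u kj≤K)
         r (allFin r) (≤-reflexive (length-tabulate (λ x → x))) ⟩
  colourWeight ℓ u (allFin r) * ramseyFactor K r
    ≡⟨ cong (_* ramseyFactor K r) (colourWeight-∈ ℓ u (∈-allFin ℓ)) ⟩
  u * ramseyFactor K r ∎)
  where open ≤-Reasoning

lookup-∷ʳ-last : ∀ {m} (ks : Vec ℕ m) u → lookup (ks ∷ʳ u) (fromℕ m) ≡ u
lookup-∷ʳ-last [] u = refl
lookup-∷ʳ-last (_ ∷ ks) u = lookup-∷ʳ-last ks u

lookup-∷ʳ-≤-sum : ∀ {m} (ks : Vec ℕ m) u j → j ≢ fromℕ m → lookup (ks ∷ʳ u) j ≤ sum ks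
lookup-∷ʳ-≤-sum [] u zero j≢last = ⊥-elim (j≢last refl)
lookup-∷ʳ-≤-sum (k ∷ ks) u zero _ = m≤m+n k (sum ks)
lookup-∷ʳ-≤-sum (k ∷ ks) u (suc j) j≢last =
  ≤-trans (lookup-∷ʳ-≤-sum ks u j (j≢last ∘ cong suc)) (m≤n+m (sum ks) k)

lookup-∷ʳ : ∀ {m} {P : ℕ → Set} (ks : Vec ℕ m) u → (∀ i → P (lookup ks i)) → P u →
            ∀ j → P (lookup (ks ∷ʳ u) j)
lookup-∷ʳ [] u _ Pu zero = Pu
lookup-∷ʳ (k ∷ ks) u Pks Pu zero = Pks zero
lookup-∷ʳ (k ∷ ks) u Pks Pu (suc j) = lookup-∷ʳ ks u (Pks ∘ suc) Pu j

schurBound-linear : ∀ {r} {ks : Vec ℕ r} {N E u} → SchurProp ks N → N ≤ u * E → 0 < u →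
                    ∀ b → SchurBound ks (suc E) b u
schurBound-linear {N = N} {E} {u} S N≤uE u>0 b = N , S , (begin
  (N + 1) * ⌊log₂ u ⌋ ^ b  ≤⟨ *-mono-≤ (+-mono-≤ N≤uE u>0) (^-monoˡ-≤ b (⌊log₂n⌋≤n u)) ⟩
  (u * E + u) * u ^ b      ≡⟨ solve 3 (λ u E X → (u :* E :+ u) :* X := (con 1 :+ E) :* (X :* (u :* con 1)))
                                    refl u E (u ^ b) ⟩
  suc E * (u ^ b * u ^ 1)  ≡⟨ cong (suc E *_) (^-distribˡ-+-* u b 1) ⟨
  suc E * u ^ (b + 1)      ∎)
  where
    open ≤-Reasoning
    open +-*-Solver

schurBound-∷ʳ : ∀ {m} (ks : Vec ℕ m) → (∀ i → 3 ≤ lookup ks i) → ∀ b →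
                Σ ℕ λ C → (0 < C) × Σ ℕ λ U → (u : ℕ) → U ≤ u → SchurBound (ks ∷ʳ u) C b u
schurBound-∷ʳ {m} ks ks≥3 b = suc E , s≤s z≤n , 2 , λ u u≥2 →
  let u>0 = ≤-trans (s≤s z≤n) u≥2
      ks∷u≥2 = lookup-∷ʳ ks u (λ i → ≤-trans (n≤1+n 2) (ks≥3 i)) u≥2
      last≤u = ≤-trans (m∸n≤m _ 2) (≤-reflexive (lookup-∷ʳ-last ks u))
      others≤K = λ j j≢last → ≤-trans (m∸n≤m _ 2) (≤-trans (lookup-∷ʳ-≤-sum ks u j j≢last) (n≤1+n _))
      S = schurProp-linear (ks ∷ʳ u) (fromℕ m) ks∷u≥2 (s≤s z≤n) u>0 last≤u others≤K
  in schurBound-linear {ks = ks ∷ʳ u} S ≤-refl u>0 b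
  where
    K E : ℕ
    K = suc (sum ks)
    E = ramseyFactor K (suc m)

corollary4p3 :
    ((m : ℕ) → 1 ≤ m → (ks : Vec ℕ m) → ((i : Fin m) → 3 ≤ lookup ks i) →
      Σ ℕ λ C → (0 < C) × Σ ℕ λ U → (u : ℕ) → U ≤ u →
        SchurBound (ks ∷ʳ u) C (excess ks) u)
    × ((s t : ℕ) → 3 ≤ s → s ≤ t →
      Σ ℕ λ C → (0 < C) × Σ ℕ λ U → (u : ℕ) → U ≤ u →
        SchurBound (s ∷ t ∷ u ∷ []) C (s + t ∸ 4) u)
corollary4p3 =
  (λ _ _ ks ks≥3 → schurBound-∷ʳ ks ks≥3 (excess ks)) ,
  (λ s t s≥3 t≥s → schurBound-∷ʳ (s ∷ t ∷ []) (pair≥3 s≥3 (≤-trans s≥3 t≥s)) (s + t ∸ 4))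
  where
    pair≥3 : ∀ {s t} → 3 ≤ s → 3 ≤ t → (i : Fin 2) → 3 ≤ lookup (s ∷ t ∷ []) i
    pair≥3 s≥3 _ zero = s≥3
    pair≥3 _ t≥3 (suc zero) = t≥3
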